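{- Let $r,M,k$ be integers with $0<r\le M/2$ and $k=\lfloor M/2\rfloor$, and let $n\ge 0$. Let $A_n(M,r)$ be the set of partitions of $n$ all of whose successive ranks lie in the interval $[-r+2,\,M-r-2]$. Let $C_n(M,r)$ be the set of $(k-1)$-color partitions $(\alpha,c_\alpha)$ of $n$, $\alpha=(\alpha_1,\dots,\alpha_l)$, satisfying: (i) for $1\le i\le l$: $\alpha_i>|2c_\alpha(i)-r+1|$ if $\alpha_i\equiv r\pmod 2$, and $\alpha_i>|2c_\alpha(i)-r|$ otherwise; (ii) for $1\le i<l$: $\alpha_i-\alpha_{i+1}\ge 2+|2(c_\alpha(i)-c_\alpha(i+1))|$ if $\alpha_i\equiv\alpha_{i+1}\pmod 2$; $\alpha_i-\alpha_{i+1}\ge 2+|2(c_\alpha(i)-c_\alpha(i+1))-1|$ if $\alpha_i\not\equiv\alpha_{i+1}\equiv r\pmod 2$; $\alpha_i-\alpha_{i+1}\ge 2+|2(c_\alpha(i)-c_\alpha(i+1))+1|$ if $\alpha_{i+1}\not\equiv\alpha_i\equiv r\pmod 2$; (iii) if $M$ is even, then for every $1\le i\le l$ with $c_\alpha(i)=k-1$ we have $\alpha_i\not\equiv r\pmod 2$. Then $|A_n(M,r)|=|C_n(M,r)|$.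
   Context: A partition of $n$ is a finite non-increasing sequence of positive integers summing to $n$. For a partition $\pi$, the conjugate $\pi'$ has $\pi'_i=\#\{j:\pi_j\ge i\}$; the Durfee square size $d(\pi)$ is the largest $d$ with $\pi_d\ge d$; the successive ranks of $\pi$ are $\pi_i-\pi'_i$ for $1\le i\le d(\pi)$. For $t\ge1$, a $t$-color partition of $n$ is a pair $(\alpha,c_\alpha)$ where $\alpha=(\alpha_1,\dots,\alpha_l)$ is a partition of $n$ and $c_\alpha:\{1,\dots,l\}\to\{1,\dots,t\}$ is a function (the color of the $i$-th part) such that $\alpha_i=\alpha_{i+1}$ implies $c_\alpha(i)\le c_\alpha(i+1)$. -}

module Defs where

open import Data.Nat as ℕ using (ℕ; zero; suc; _≤_; _<_; _≤?_)
open import Data.Nat.DivMod using (_/_; _%_)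
open import Data.Integer as ℤ using (ℤ; +_; ∣_∣)
open import Data.List using (List; []; _∷_; length; filter; map)
open import Data.Nat.ListAction using (sum)
open import Data.List.Relation.Unary.All using (All)
open import Data.List.Relation.Unary.Linked using (Linked)
open import Data.Product using (_×_; _,_; proj₁; proj₂; Σ)
open import Data.Sum using (_⊎_)
open import Relation.Binary.PropositionalEquality using (_≡_; _≢_)
open import Relation.Nullary using (¬_)

IsPartition : ℕ → List ℕ → Set
IsPartition n π = All (λ a → 1 ≤ a) π × Linked ℕ._≥_ π × sum π ≡ n

-- 1-indexed lookup  π_i ; returns 0 out of range (i = 0 or i > length)
part : List ℕ → ℕ → ℕ
part []       _             = 0
part (a ∷ π)  zero          = 0
part (a ∷ π)  (suc zero)    = a
part (a ∷ π)  (suc (suc i)) = part π (suc i)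

conj : List ℕ → ℕ → ℕ
conj π i = length (filter (i ≤?_) π)

-- Durfee square size: largest d (0 if none) with 1 ≤ d ≤ length π and π_d ≥ d
durfeeFrom : ℕ → List ℕ → ℕ
durfeeFrom i []      = 0
durfeeFrom i (a ∷ π) with suc i ≤? a
... | Relation.Nullary.yes _ = suc i ℕ.⊔ durfeeFrom (suc i) π
... | Relation.Nullary.no  _ = durfeeFrom (suc i) π

durfee : List ℕ → ℕ
durfee π = durfeeFrom 0 π

srank : List ℕ → ℕ → ℤ
srank π i = (+ part π i) ℤ.- (+ conj π i)

InA : ℕ → ℕ → ℕ → List ℕ → Set
InA M r n π = IsPartition n π ×
  (∀ i → 1 ≤ i → i ≤ durfee π →
     ((+ 2) ℤ.- (+ r) ℤ.≤ srank π i) × (srank π i ℤ.≤ (+ M) ℤ.- (+ r) ℤ.- (+ 2)))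

ColStep : ℕ × ℕ → ℕ × ℕ → Set
ColStep (a , c) (b , d) = (b ℕ.≤ a) × (a ≡ b → c ℕ.≤ d)

IsColorPartition : ℕ → ℕ → List (ℕ × ℕ) → Set
IsColorPartition t n α =
  All (λ p → (1 ≤ proj₁ p) × (1 ≤ proj₂ p) × (proj₂ p ≤ t)) α ×
  Linked ColStep α ×
  sum (map proj₁ α) ≡ n

_≡₂_ : ℕ → ℕ → Set
a ≡₂ b = a % 2 ≡ b % 2

twoC : ℕ → ℤ
twoC c = + (2 ℕ.* c)

CondI : ℕ → ℕ × ℕ → Set
CondI r (a , c) =
  (a ≡₂ r → ∣ twoC c ℤ.- (+ r) ℤ.+ (+ 1) ∣ < a) ×
  (¬ (a ≡₂ r) → ∣ twoC c ℤ.- (+ r) ∣ < a)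

CondII : ℕ → ℕ × ℕ → ℕ × ℕ → Set
CondII r (a , c) (b , d) =
  (a ≡₂ b → 2 ℕ.+ ∣ twoC c ℤ.- twoC d ∣ ≤ a ℕ.∸ b) ×
  (¬ (a ≡₂ b) → b ≡₂ r → 2 ℕ.+ ∣ twoC c ℤ.- twoC d ℤ.- (+ 1) ∣ ≤ a ℕ.∸ b) ×
  (¬ (b ≡₂ a) → a ≡₂ r → 2 ℕ.+ ∣ twoC c ℤ.- twoC d ℤ.+ (+ 1) ∣ ≤ a ℕ.∸ b)

CondIII : ℕ → ℕ → ℕ → ℕ × ℕ → Set
CondIII M k r (a , c) = M ≡₂ 0 → c ≡ k ℕ.∸ 1 → ¬ (a ≡₂ r)

InC : ℕ → ℕ → ℕ → List (ℕ × ℕ) → Set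
InC M r n α =
  IsColorPartition (M / 2 ℕ.∸ 1) n α ×
  All (CondI r) α ×
  Linked (CondII r) α ×
  All (CondIII M (M / 2) r) α

-- Equinumerosity of two subsets {x : P x} ⊆ A and {y : Q y} ⊆ B:
-- a bijection between the subsets, with equality of elements measured on
-- the underlying objects (not on the membership proofs).

record Equinumerous {A B : Set} (P : A → Set) (Q : B → Set) : Set where
  field
    to       : Σ A P → Σ B Q
    from     : Σ B Q → Σ A P
    from∘to  : ∀ x → proj₁ (from (to x)) ≡ proj₁ x
    to∘from  : ∀ y → proj₁ (to (from y)) ≡ proj₁ y

-- Frobenius coordinates turn a partition into the strictly decreasing list of
-- its diagonal hooks (a_i , b_i) (arm and leg lengths): the successive ranks are
-- a_i - b_i and n is the sum of the hook lengths a_i + b_i + 1.  A hook (a , b)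
-- whose rank lies in [2 - r , M - r - 2] is sent to the coloured part (h , c)
-- with h = a + b + 1 and a - b + r = 2c + [h ≡ r (mod 2)].  Under this map the
-- rank bounds become 1 ≤ c ≤ k - 1 together with condition (iii), condition (i)
-- reads |a - b| < a + b + 1 and always holds, and for consecutive hooks
-- condition (ii) reads 2 + |Δa - Δb| ≤ Δa + Δb, i.e. both arms and legs
-- strictly decrease.  Mapping the hooks one by one is therefore a bijection.

module Submission where

open import Defs
open import Data.Empty using (⊥-elim)
open import Data.Integer as ℤ using (ℤ; _⊖_; ∣_∣; -[1+_])
import Data.Integer.Properties as ℤ
open import Data.List using (List; []; _∷_; length; filter; map; _++_; replicate; head)
open import Data.List.Properties
  using (length-++; length-map; length-replicate; filter-++; filter-accept; filter-reject; filter-all;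
         map-∘; map-id-local; map-cong-local)
open import Data.List.Relation.Unary.All as All using (All; []; _∷_)
import Data.List.Relation.Unary.All.Properties as All
open import Data.List.Relation.Unary.Linked using (Linked; []; [-]; _∷_; _∷′_)
import Data.List.Relation.Unary.Linked as Linked
import Data.List.Relation.Unary.Linked.Properties as Linked
open import Data.Maybe using (just)
open import Data.Maybe.Relation.Binary.Connected using (Connected; just; just-nothing)
open import Data.Nat as ℕ using (ℕ; zero; suc; _+_; _*_; _∸_; _≤_; _<_; _≥_; _≤?_; _⊔_; z≤n; s≤s)
open import Data.Nat.DivMod
  using (_%_; _/_; [m+kn]%n≡m%n; m≡m%n+[m/n]*n; m%n<n; m*n/n≡m; m*n%n≡0; +-distrib-/)
open import Data.Nat.ListAction using (sum)
open import Data.Nat.ListAction.Properties using (sum-++)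
open import Data.Nat.Properties
open import Algebra.Properties.CommutativeSemigroup +-commutativeSemigroup using (x∙yz≈y∙xz; xy∙z≈y∙xz)
open import Data.Nat.Tactic.RingSolver using (solve-∀)
open import Data.Product using (_×_; _,_; proj₁; proj₂)
open import Data.Sum using (_⊎_; inj₁; inj₂)
open import Function.Base using (_∘_; case_of_)
open import Function.Bundles using (_⇔_; mk⇔; Equivalence)
open import Relation.Binary.PropositionalEquality
open import Relation.Nullary using (¬_; yes; no)

-- Unlike Equinumerous, the maps ignore the membership proofs, which is what
-- makes restricted bijections compose.
record RestrictedBijection {A B : Set} (P : A → Set) (Q : B → Set) : Set where
  field
    to        : A → B
    from      : B → A
    to-pres   : ∀ {x} → P x → Q (to x)
    from-pres : ∀ {y} → Q y → P (from y)
    from∘to   : ∀ {x} → P x → from (to x) ≡ x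
    to∘from   : ∀ {y} → Q y → to (from y) ≡ y

restrictedBijection-trans : ∀ {A B C : Set} {P : A → Set} {Q : B → Set} {R : C → Set} →
                            RestrictedBijection P Q → RestrictedBijection Q R → RestrictedBijection P R
restrictedBijection-trans f g = record
  { to        = λ x → G.to (F.to x)
  ; from      = λ z → F.from (G.from z)
  ; to-pres   = λ p → G.to-pres (F.to-pres p)
  ; from-pres = λ r → F.from-pres (G.from-pres r)
  ; from∘to   = λ p → trans (cong F.from (G.from∘to (F.to-pres p))) (F.from∘to p)
  ; to∘from   = λ r → trans (cong G.to (F.to∘from (G.from-pres r))) (G.to∘from r)
  }
  where
  module F = RestrictedBijection f
  module G = RestrictedBijection g

restrictedBijection⇒equinumerous : ∀ {A B : Set} {P : A → Set} {Q : B → Set} →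
                                   RestrictedBijection P Q → Equinumerous P Q
restrictedBijection⇒equinumerous f = record
  { to      = λ (x , p) → F.to x , F.to-pres p
  ; from    = λ (y , q) → F.from y , F.from-pres q
  ; from∘to = λ (_ , p) → F.from∘to p
  ; to∘from = λ (_ , q) → F.to∘from q
  }
  where
  module F = RestrictedBijection f

-- Integer arithmetic

[+m]-[+n]+1≡1+m⊖n : ∀ m n → ℤ.+ m ℤ.- ℤ.+ n ℤ.+ ℤ.+ 1 ≡ suc m ⊖ n
[+m]-[+n]+1≡1+m⊖n m n = begin
  ℤ.+ m ℤ.- ℤ.+ n ℤ.+ ℤ.+ 1 ≡⟨ cong (ℤ._+ ℤ.+ 1) (ℤ.[+m]-[+n]≡m⊖n m n) ⟩
  m ⊖ n ℤ.+ ℤ.+ 1           ≡⟨ ℤ.distribˡ-⊖-+-pos 1 m n ⟩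
  (m + 1) ⊖ n               ≡⟨ cong (_⊖ n) (+-comm m 1) ⟩
  suc m ⊖ n                 ∎
  where open ≡-Reasoning

[+m]-[+n]-1≡m⊖1+n : ∀ m n → ℤ.+ m ℤ.- ℤ.+ n ℤ.- ℤ.+ 1 ≡ m ⊖ suc n
[+m]-[+n]-1≡m⊖1+n m n = begin
  ℤ.+ m ℤ.- ℤ.+ n ℤ.- ℤ.+ 1 ≡⟨ cong (ℤ._+ -[1+ 0 ]) (ℤ.[+m]-[+n]≡m⊖n m n) ⟩
  m ⊖ n ℤ.+ -[1+ 0 ]        ≡⟨ ℤ.distribˡ-⊖-+-neg 0 m n ⟩
  m ⊖ (suc n + 0)           ≡⟨ cong (m ⊖_) (+-identityʳ (suc n)) ⟩
  m ⊖ suc n                 ∎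
  where open ≡-Reasoning

[+m]-[+n]-2≡m⊖[n+2] : ∀ m n → ℤ.+ m ℤ.- ℤ.+ n ℤ.- ℤ.+ 2 ≡ m ⊖ (n + 2)
[+m]-[+n]-2≡m⊖[n+2] m n = begin
  ℤ.+ m ℤ.- ℤ.+ n ℤ.- ℤ.+ 2 ≡⟨ cong (ℤ._+ -[1+ 1 ]) (ℤ.[+m]-[+n]≡m⊖n m n) ⟩
  m ⊖ n ℤ.+ -[1+ 1 ]        ≡⟨ ℤ.distribˡ-⊖-+-neg 1 m n ⟩
  m ⊖ (suc n + 1)           ≡⟨ cong (m ⊖_) (trans (cong suc (+-comm n 1)) (+-comm 2 n)) ⟩
  m ⊖ (n + 2)               ∎
  where open ≡-Reasoning

+≡+⇒⊖≡⊖ : ∀ {m n o p} → m + n ≡ o + p → m ⊖ o ≡ p ⊖ n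
+≡+⇒⊖≡⊖ {m} {n} {o} {p} eq = begin
  m ⊖ o             ≡⟨ ℤ.+-cancelˡ-⊖ n m o ⟨
  (n + m) ⊖ (n + o) ≡⟨ cong₂ _⊖_ (trans (+-comm n m) eq) (+-comm n o) ⟩
  (o + p) ⊖ (o + n) ≡⟨ ℤ.+-cancelˡ-⊖ o p n ⟩
  p ⊖ n             ∎
  where open ≡-Reasoning

⊖-monoˡ-≤⇔ : ∀ {m n} o → m ⊖ o ℤ.≤ n ⊖ o ⇔ m ≤ n
⊖-monoˡ-≤⇔ {m} {n} o = mk⇔
  (λ le → case m ≤? n of λ where
    (yes m≤n) → m≤n
    (no  m≰n) → ⊥-elim (ℤ.<⇒≱ (ℤ.⊖-monoˡ-< o (≰⇒> m≰n)) le))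
  (ℤ.⊖-monoˡ-≤ o)

⊖≤⊖⇔ : ∀ m n o p → m ⊖ n ℤ.≤ o ⊖ p ⇔ m + p ≤ o + n
⊖≤⊖⇔ m n o p = mk⇔
  (λ le → Equivalence.to (⊖-monoˡ-≤⇔ (n + p)) (subst₂ ℤ._≤_ m⊖n≡ o⊖p≡ le))
  (λ le → subst₂ ℤ._≤_ (sym m⊖n≡) (sym o⊖p≡) (Equivalence.from (⊖-monoˡ-≤⇔ (n + p)) le))
  where
  m⊖n≡ : m ⊖ n ≡ (m + p) ⊖ (n + p)
  m⊖n≡ = +≡+⇒⊖≡⊖ {m} {n + p} {n} {m + p} (x∙yz≈y∙xz m n p)
  o⊖p≡ : o ⊖ p ≡ (o + n) ⊖ (n + p)
  o⊖p≡ = +≡+⇒⊖≡⊖ {o} {n + p} {p} {o + n} (trans (sym (+-assoc o n p)) (+-comm (o + n) p))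

m≤n+∣m⊖n∣ : ∀ m n → m ≤ n + ∣ m ⊖ n ∣
m≤n+∣m⊖n∣ m n with ≤-total m n
... | inj₁ m≤n = ≤-trans m≤n (m≤m+n n _)
... | inj₂ n≤m = ≤-reflexive (begin
  m             ≡⟨ m+[n∸m]≡n n≤m ⟨
  n + (m ∸ n)   ≡⟨ cong (n +_) (trans (ℤ.∣m⊖n∣≡∣n⊖m∣ m n) (ℤ.∣⊖∣-≤ n≤m)) ⟨
  n + ∣ m ⊖ n ∣ ∎)
  where open ≡-Reasoning

+∣⊖∣≤⇒ : ∀ k {x y d} → k + ∣ x ⊖ y ∣ ≤ d → k + x ≤ y + d
+∣⊖∣≤⇒ k {x} {y} {d} bound = begin
  k + x               ≤⟨ +-monoʳ-≤ k (m≤n+∣m⊖n∣ x y) ⟩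
  k + (y + ∣ x ⊖ y ∣) ≡⟨ x∙yz≈y∙xz k y _ ⟩
  y + (k + ∣ x ⊖ y ∣) ≤⟨ +-monoʳ-≤ y bound ⟩
  y + d               ∎
  where open ≤-Reasoning

-- Parity and halving

%2≡0⊎%2≡1 : ∀ n → n % 2 ≡ 0 ⊎ n % 2 ≡ 1
%2≡0⊎%2≡1 zero          = inj₁ refl
%2≡0⊎%2≡1 (suc zero)    = inj₂ refl
%2≡0⊎%2≡1 (suc (suc n)) = %2≡0⊎%2≡1 n

n%2≤1 : ∀ n → n % 2 ≤ 1
n%2≤1 n = ≤-pred (m%n<n n 2)

n≢₂1+n : ∀ n → ¬ (n ≡₂ suc n)
n≢₂1+n zero          ()
n≢₂1+n (suc zero)    ()
n≢₂1+n (suc (suc n)) = n≢₂1+n n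

≢₂-≢₂⇒≡₂ : ∀ {x y z} → ¬ (x ≡₂ y) → ¬ (y ≡₂ z) → x ≡₂ z
≢₂-≢₂⇒≡₂ {x} {y} {z} x≢y y≢z with %2≡0⊎%2≡1 x | %2≡0⊎%2≡1 y | %2≡0⊎%2≡1 z
... | inj₁ x0 | inj₁ y0 | _       = ⊥-elim (x≢y (trans x0 (sym y0)))
... | inj₂ x1 | inj₂ y1 | _       = ⊥-elim (x≢y (trans x1 (sym y1)))
... | _       | inj₁ y0 | inj₁ z0 = ⊥-elim (y≢z (trans y0 (sym z0)))
... | _       | inj₂ y1 | inj₂ z1 = ⊥-elim (y≢z (trans y1 (sym z1)))
... | inj₁ x0 | inj₂ _  | inj₁ z0 = trans x0 (sym z0)
... | inj₂ x1 | inj₁ _  | inj₂ z1 = trans x1 (sym z1)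

2*m+n≡₂n : ∀ m n → (2 * m + n) ≡₂ n
2*m+n≡₂n m n = trans (cong (_% 2) (trans (+-comm (2 * m) n) (cong (n +_) (*-comm 2 m)))) ([m+kn]%n≡m%n n m 2)

n≡n%2+2*[n/2] : ∀ n → n ≡ n % 2 + 2 * (n / 2)
n≡n%2+2*[n/2] n = trans (m≡m%n+[m/n]*n n 2) (cong (n % 2 +_) (*-comm (n / 2) 2))

+%2≡₂+ : ∀ s x → (s + x % 2) ≡₂ (s + x)
+%2≡₂+ s x = sym (begin
  (s + x) % 2                     ≡⟨ cong (λ y → (s + y) % 2) (n≡n%2+2*[n/2] x) ⟩
  (s + (x % 2 + 2 * (x / 2))) % 2 ≡⟨ cong (_% 2) (rearrange s (x % 2) (x / 2)) ⟩
  (2 * (x / 2) + (s + x % 2)) % 2 ≡⟨ 2*m+n≡₂n (x / 2) (s + x % 2) ⟩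
  (s + x % 2) % 2                 ∎)
  where
  open ≡-Reasoning
  rearrange : ∀ s p m → s + (p + 2 * m) ≡ 2 * m + (s + p)
  rearrange = solve-∀

+-cancelˡ-≡₂-bit : ∀ s {p q} → p ≤ 1 → q ≤ 1 → (s + p) ≡₂ (s + q) → p ≡ q
+-cancelˡ-≡₂-bit s z≤n       z≤n       _ = refl
+-cancelˡ-≡₂-bit s (s≤s z≤n) (s≤s z≤n) _ = refl
+-cancelˡ-≡₂-bit s z≤n       (s≤s z≤n) e =
  ⊥-elim (n≢₂1+n s (subst₂ _≡₂_ (+-identityʳ s) (+-comm s 1) e))
+-cancelˡ-≡₂-bit s (s≤s z≤n) z≤n       e =
  ⊥-elim (n≢₂1+n s (subst₂ _≡₂_ (+-identityʳ s) (+-comm s 1) (sym e)))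

+≡₂⇒even : ∀ m e → (m + e) ≡₂ m → e % 2 ≡ 0
+≡₂⇒even m e m+e≡₂m = +-cancelˡ-≡₂-bit m (n%2≤1 e) z≤n
  (trans (+%2≡₂+ m e) (trans m+e≡₂m (cong (_% 2) (sym (+-identityʳ m)))))

[bit+2*n]/2≡n : ∀ {q} n → q ≤ 1 → (q + 2 * n) / 2 ≡ n
[bit+2*n]/2≡n n z≤n       = trans (cong (_/ 2) (*-comm 2 n)) (m*n/n≡m n 2)
[bit+2*n]/2≡n n (s≤s z≤n) = begin
  (1 + 2 * n) / 2   ≡⟨ +-distrib-/ 1 (2 * n) (subst (λ z → 1 + z < 2) (sym 2n%2≡0) ≤-refl) ⟩
  1 / 2 + 2 * n / 2 ≡⟨ [bit+2*n]/2≡n n z≤n ⟩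
  n                 ∎
  where
  open ≡-Reasoning
  2n%2≡0 : (2 * n) % 2 ≡ 0
  2n%2≡0 = trans (cong (_% 2) (*-comm 2 n)) (m*n%n≡0 n 2)

bit≤bit⇔ : ∀ {q m} → q ≤ 1 → m ≤ 1 → q ≤ m ⇔ (m ≡ 0 → q ≡ 0)
bit≤bit⇔ z≤n       _         = mk⇔ (λ _ _ → refl) (λ _ → z≤n)
bit≤bit⇔ (s≤s z≤n) z≤n       = mk⇔ (λ ()) (λ q≡0 → case q≡0 refl of λ ())
bit≤bit⇔ (s≤s z≤n) (s≤s z≤n) = mk⇔ (λ _ ()) (λ _ → ≤-refl)

bit+2*n≤bit+2*k⇔ : ∀ {q m} n k → q ≤ 1 → m ≤ 1 →
                   q + 2 * n ≤ m + 2 * k ⇔ (n ≤ k × (n ≡ k → q ≤ m))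
bit+2*n≤bit+2*k⇔ {q} {m} zero zero _ _ = mk⇔
  (λ le → z≤n , λ _ → subst₂ _≤_ (+-identityʳ q) (+-identityʳ m) le)
  (λ (_ , q≤m) → subst₂ _≤_ (sym (+-identityʳ q)) (sym (+-identityʳ m)) (q≤m refl))
bit+2*n≤bit+2*k⇔ {q} {m} zero (suc k) q≤1 _ = mk⇔
  (λ _ → z≤n , λ ())
  (λ _ → ≤-trans (≤-reflexive (+-identityʳ q)) (≤-trans q≤1 (m≤n⇒m≤o+n m (s≤s z≤n))))
bit+2*n≤bit+2*k⇔ {q} {m} (suc n) zero _ m≤1 = mk⇔
  (λ le → ⊥-elim (<⇒≱ (s≤s m≤1) (begin
    2                 ≤⟨ m≤m+n 2 (q + 2 * n) ⟩
    2 + (q + 2 * n)   ≡⟨ shift q n ⟨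
    q + 2 * suc n     ≤⟨ le ⟩
    m + 0             ≡⟨ +-identityʳ m ⟩
    m                 ∎)))
  (λ ())
  where
  open ≤-Reasoning
  shift : ∀ q n → q + 2 * suc n ≡ 2 + (q + 2 * n)
  shift = solve-∀
bit+2*n≤bit+2*k⇔ {q} {m} (suc n) (suc k) q≤1 m≤1 = mk⇔
  (λ le → let n≤k , q≤m = Equivalence.to IH (+-cancelˡ-≤ 2 _ _ (subst₂ _≤_ (shift q n) (shift m k) le))
          in s≤s n≤k , λ e → q≤m (suc-injective e))
  (λ (1+n≤1+k , q≤m) → subst₂ _≤_ (sym (shift q n)) (sym (shift m k))
                         (+-monoʳ-≤ 2 (Equivalence.from IH (≤-pred 1+n≤1+k , λ e → q≤m (cong suc e)))))
  where
  IH = bit+2*n≤bit+2*k⇔ n k q≤1 m≤1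
  shift : ∀ q n → q + 2 * suc n ≡ 2 + (q + 2 * n)
  shift = solve-∀

colourBounds⇔ : ∀ {q m} c k → q ≤ 1 → m ≤ 1 →
                (1 ≤ c × c ≤ k ∸ 1 × (m ≡ 0 → c ≡ k ∸ 1 → q ≡ 0)) ⇔
                (2 ≤ q + 2 * c × q + 2 * c + 2 ≤ m + 2 * k)
colourBounds⇔ {q} zero _ q≤1 _ = mk⇔
  (λ ())
  (λ (2≤q , _) → ⊥-elim (<⇒≱ (s≤s q≤1) (subst (2 ≤_) (+-identityʳ q) 2≤q)))
colourBounds⇔ {q} {m} (suc c) zero _ m≤1 = mk⇔
  (λ ())
  (λ (_ , le) → ⊥-elim (<⇒≱ (s≤s m≤1)
    (≤-trans (m≤n+m 2 (q + 2 * suc c)) (subst (q + 2 * suc c + 2 ≤_) (+-identityʳ m) le))))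
colourBounds⇔ {q} {m} (suc c) (suc k) q≤1 m≤1 = mk⇔
  (λ (_ , c<k , cond) →
     lower , upper⇐ (Equivalence.from core (c<k , λ e → Equivalence.from bits (λ m≡0 → cond m≡0 e))))
  (λ (_ , le) → let c<k , q≤m = Equivalence.to core (upper⇒ le)
                in s≤s z≤n , c<k , λ m≡0 e → Equivalence.to bits (q≤m e) m≡0)
  where
  core = bit+2*n≤bit+2*k⇔ (suc c) k q≤1 m≤1
  bits = bit≤bit⇔ q≤1 m≤1
  shiftˡ : ∀ q c → q + 2 * suc c + 2 ≡ 2 + (q + 2 * suc c)
  shiftˡ = solve-∀
  shiftʳ : ∀ m k → m + 2 * suc k ≡ 2 + (m + 2 * k)
  shiftʳ = solve-∀
  lower : 2 ≤ q + 2 * suc c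
  lower = ≤-trans (*-monoʳ-≤ 2 (s≤s z≤n)) (m≤n+m _ q)
  upper⇒ : q + 2 * suc c + 2 ≤ m + 2 * suc k → q + 2 * suc c ≤ m + 2 * k
  upper⇒ le = +-cancelˡ-≤ 2 _ _ (subst₂ _≤_ (shiftˡ q c) (shiftʳ m k) le)
  upper⇐ : q + 2 * suc c ≤ m + 2 * k → q + 2 * suc c + 2 ≤ m + 2 * suc k
  upper⇐ le = subst₂ _≤_ (sym (shiftˡ q c)) (sym (shiftʳ m k)) (+-monoʳ-≤ 2 le)

-- Frobenius symbols

infix 4 _≻_

_≻_ : ℕ × ℕ → ℕ × ℕ → Set
(a , b) ≻ (a′ , b′) = a′ < a × b′ < b

FrobeniusSymbol : List (ℕ × ℕ) → Set
FrobeniusSymbol = Linked _≻_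

Positive : List ℕ → Set
Positive = All (1 ≤_)

NonIncreasing : List ℕ → Set
NonIncreasing = Linked _≥_

addColumn : List ℕ → ℕ → List ℕ
addColumn μ k = map suc μ ++ replicate k 1

removeColumn : List ℕ → List ℕ
removeColumn []                 = []
removeColumn (zero ∷ _)         = []
removeColumn (suc zero ∷ _)     = []
removeColumn (suc (suc x) ∷ xs) = suc x ∷ removeColumn xs

-- Wraps the hook with arm a and leg b around partitionOf f, padding the first
-- column with ones up to length b + 1.
partitionOf : List (ℕ × ℕ) → List ℕ
partitionOf []            = []
partitionOf ((a , b) ∷ f) = suc a ∷ addColumn μ (b ∸ length μ)
  where μ = partitionOf f

hook : ℕ × ℕ → ℕ
hook (a , b) = suc (a + b)

-- k is fuel: length π suffices, since removeColumn never lengthens a list.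
symbolWithin : ℕ → List ℕ → List (ℕ × ℕ)
symbolWithin zero    _          = []
symbolWithin (suc k) []         = []
symbolWithin (suc k) (p ∷ rest) = (ℕ.pred p , length rest) ∷ symbolWithin k (removeColumn rest)

frobeniusSymbol : List ℕ → List (ℕ × ℕ)
frobeniusSymbol π = symbolWithin (length π) π

length-addColumn : ∀ μ k → length (addColumn μ k) ≡ length μ + k
length-addColumn μ k = begin
  length (map suc μ ++ replicate k 1)           ≡⟨ length-++ (map suc μ) ⟩
  length (map suc μ) + length (replicate k 1)   ≡⟨ cong₂ _+_ (length-map suc μ) (length-replicate k) ⟩
  length μ + k                                  ∎
  where open ≡-Reasoning

length-partitionOf-tail≤ : ∀ {a b f} → FrobeniusSymbol ((a , b) ∷ f) → length (partitionOf f) ≤ b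
length-partitionOf : ∀ {a b f} → FrobeniusSymbol ((a , b) ∷ f) →
                     length (partitionOf ((a , b) ∷ f)) ≡ suc b

length-partitionOf-tail≤         {f = []}    _                = z≤n
length-partitionOf-tail≤ {b = b} {f = _ ∷ _} ((_ , b′<b) ∷ s) =
  subst (_≤ b) (sym (length-partitionOf s)) b′<b

length-partitionOf {b = b} {f} s = cong suc (begin
  length (addColumn μ (b ∸ length μ)) ≡⟨ length-addColumn μ _ ⟩
  length μ + (b ∸ length μ)           ≡⟨ m+[n∸m]≡n (length-partitionOf-tail≤ s) ⟩
  b                                   ∎)
  where
  open ≡-Reasoning
  μ = partitionOf f

length-tail≤ : ∀ {a b f} → FrobeniusSymbol ((a , b) ∷ f) → length f ≤ a × length f ≤ b
length-tail≤ {f = []}    _                      = z≤n , z≤n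
length-tail≤ {f = _ ∷ _} ((a′<a , b′<b) ∷ s) with length-tail≤ s
... | ≤a′ , ≤b′ = ≤-trans (s≤s ≤a′) a′<a , ≤-trans (s≤s ≤b′) b′<b

length≤length-partitionOf : ∀ {f} → FrobeniusSymbol f → length f ≤ length (partitionOf f)
length≤length-partitionOf {[]}        _ = z≤n
length≤length-partitionOf {f@(_ ∷ _)} s =
  subst (length f ≤_) (sym (length-partitionOf s)) (s≤s (proj₂ (length-tail≤ s)))

positive-addColumn : ∀ μ k → Positive (addColumn μ k)
positive-addColumn []      zero    = []
positive-addColumn []      (suc k) = s≤s z≤n ∷ positive-addColumn [] k
positive-addColumn (_ ∷ μ) k       = s≤s z≤n ∷ positive-addColumn μ k

positive-partitionOf : ∀ f → Positive (partitionOf f)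
positive-partitionOf []      = []
positive-partitionOf (_ ∷ f) = s≤s z≤n ∷ positive-addColumn (partitionOf f) _

nonIncreasing-ones : ∀ k → NonIncreasing (replicate k 1)
nonIncreasing-ones zero          = []
nonIncreasing-ones (suc zero)    = [-]
nonIncreasing-ones (suc (suc k)) = ≤-refl ∷ nonIncreasing-ones (suc k)

nonIncreasing-addColumn : ∀ {μ} k → NonIncreasing μ → NonIncreasing (addColumn μ k)
nonIncreasing-addColumn         k       []        = nonIncreasing-ones k
nonIncreasing-addColumn         zero    [-]       = [-]
nonIncreasing-addColumn         (suc k) [-]       = s≤s z≤n ∷ nonIncreasing-ones (suc k)
nonIncreasing-addColumn {_ ∷ _} k       (x≥y ∷ d) = s≤s x≥y ∷ nonIncreasing-addColumn k d

nonIncreasing-partitionOf : ∀ {f} → FrobeniusSymbol f → NonIncreasing (partitionOf f)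
nonIncreasing-partitionOf {[]}               _ = []
nonIncreasing-partitionOf {(a , b) ∷ []}     _ with b
... | zero  = [-]
... | suc k = s≤s z≤n ∷ nonIncreasing-ones (suc k)
nonIncreasing-partitionOf {_ ∷ _ ∷ _} ((a′<a , _) ∷ s) =
  s≤s a′<a ∷ nonIncreasing-addColumn _ (nonIncreasing-partitionOf s)

sum-map-suc : ∀ xs → sum (map suc xs) ≡ length xs + sum xs
sum-map-suc []       = refl
sum-map-suc (x ∷ xs) =
  trans (cong (suc x +_) (sum-map-suc xs)) (cong suc (x∙yz≈y∙xz x (length xs) (sum xs)))

sum-ones : ∀ k → sum (replicate k 1) ≡ k
sum-ones zero    = refl
sum-ones (suc k) = cong suc (sum-ones k)

sum-addColumn : ∀ μ k → sum (addColumn μ k) ≡ sum μ + (length μ + k)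
sum-addColumn μ k = begin
  sum (map suc μ ++ replicate k 1)           ≡⟨ sum-++ (map suc μ) (replicate k 1) ⟩
  sum (map suc μ) + sum (replicate k 1)      ≡⟨ cong₂ _+_ (sum-map-suc μ) (sum-ones k) ⟩
  length μ + sum μ + k                       ≡⟨ xy∙z≈y∙xz (length μ) (sum μ) k ⟩
  sum μ + (length μ + k)                     ∎
  where open ≡-Reasoning

sum-partitionOf : ∀ {f} → FrobeniusSymbol f → sum (partitionOf f) ≡ sum (map hook f)
sum-partitionOf {[]}          _ = refl
sum-partitionOf {(a , b) ∷ f} s = begin
  suc a + sum (addColumn μ (b ∸ length μ))      ≡⟨ cong (suc a +_) (sum-addColumn μ _) ⟩
  suc a + (sum μ + (length μ + (b ∸ length μ)))
    ≡⟨ cong (λ l → suc a + (sum μ + l)) (m+[n∸m]≡n (length-partitionOf-tail≤ s)) ⟩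
  suc a + (sum μ + b)
    ≡⟨ cong (λ t → suc a + (t + b)) (sum-partitionOf (Linked.tail s)) ⟩
  suc a + (sum (map hook f) + b)                ≡⟨ cong (suc a +_) (+-comm _ b) ⟩
  suc a + (b + sum (map hook f))                ≡⟨ cong suc (+-assoc a b _) ⟨
  hook (a , b) + sum (map hook f)               ∎
  where
  open ≡-Reasoning
  μ = partitionOf f

durfeeFrom-++ : ∀ i xs ys → durfeeFrom (i + length xs) ys ≡ 0 → durfeeFrom i (xs ++ ys) ≡ durfeeFrom i xs
durfeeFrom-++ i []       ys d≡0 = trans (cong (λ j → durfeeFrom j ys) (sym (+-identityʳ i))) d≡0
durfeeFrom-++ i (x ∷ xs) ys d≡0
  with suc i ≤? x
     | durfeeFrom-++ (suc i) xs ys (trans (cong (λ j → durfeeFrom j ys) (sym (+-suc i (length xs)))) d≡0)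
... | yes _ | ih = cong (suc i ⊔_) ih
... | no  _ | ih = ih

durfeeFrom-ones : ∀ i k → durfeeFrom (suc i) (replicate k 1) ≡ 0
durfeeFrom-ones i zero    = refl
durfeeFrom-ones i (suc k) with suc (suc i) ≤? 1
... | no _          = durfeeFrom-ones (suc i) k
... | yes (s≤s ())

-- The 1 ⊔ is needed because durfeeFrom returns 0, not i, when it finds nothing.
durfeeFrom-map-suc : ∀ i xs → 1 ⊔ durfeeFrom (suc i) (map suc xs) ≡ suc (durfeeFrom i xs)
durfeeFrom-map-suc i []       = refl
durfeeFrom-map-suc i (x ∷ xs) with suc (suc i) ≤? suc x | suc i ≤? x
... | yes _ | yes _ = begin
  1 ⊔ (suc (suc i) ⊔ D)               ≡⟨ ⊔-assoc 1 (suc (suc i)) D ⟨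
  suc (suc i) ⊔ D                     ≡⟨ cong (λ m → suc m ⊔ D) (⊔-identityʳ (suc i)) ⟨
  (suc (suc i) ⊔ 1) ⊔ D               ≡⟨ ⊔-assoc (suc (suc i)) 1 D ⟩
  suc (suc i) ⊔ (1 ⊔ D)               ≡⟨ cong (suc (suc i) ⊔_) (durfeeFrom-map-suc (suc i) xs) ⟩
  suc (suc i ⊔ durfeeFrom (suc i) xs) ∎
  where
  open ≡-Reasoning
  D = durfeeFrom (suc (suc i)) (map suc xs)
... | yes p | no ¬q = ⊥-elim (¬q (≤-pred p))
... | no ¬p | yes q = ⊥-elim (¬p (s≤s q))
... | no _  | no _  = durfeeFrom-map-suc (suc i) xs

durfee-addHook : ∀ a μ k → durfee (suc a ∷ addColumn μ k) ≡ suc (durfee μ)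
durfee-addHook a μ k = begin
  1 ⊔ durfeeFrom 1 (map suc μ ++ replicate k 1)
    ≡⟨ cong (1 ⊔_) (durfeeFrom-++ 1 (map suc μ) _ (durfeeFrom-ones _ k)) ⟩
  1 ⊔ durfeeFrom 1 (map suc μ)                  ≡⟨ durfeeFrom-map-suc 0 μ ⟩
  suc (durfee μ)                                ∎
  where open ≡-Reasoning

durfee-partitionOf : ∀ f → durfee (partitionOf f) ≡ length f
durfee-partitionOf []            = refl
durfee-partitionOf ((a , _) ∷ f) =
  trans (durfee-addHook a (partitionOf f) _) (cong suc (durfee-partitionOf f))

part-addColumn : ∀ μ k {j} → j < length μ → part (addColumn μ k) (suc j) ≡ suc (part μ (suc j))
part-addColumn (x ∷ μ) k {zero}  _         = refl
part-addColumn (x ∷ μ) k {suc j} (s≤s j<l) = part-addColumn μ k j<l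

conj-map-suc : ∀ xs i → conj (map suc xs) (suc i) ≡ conj xs i
conj-map-suc []       i = refl
conj-map-suc (x ∷ xs) i with i ≤? x
... | yes i≤x = begin
  conj (suc x ∷ map suc xs) (suc i) ≡⟨ cong length (filter-accept (suc i ≤?_) (s≤s i≤x)) ⟩
  suc (conj (map suc xs) (suc i))   ≡⟨ cong suc (conj-map-suc xs i) ⟩
  suc (conj xs i)                   ≡⟨ cong length (filter-accept (i ≤?_) i≤x) ⟨
  conj (x ∷ xs) i                   ∎
  where open ≡-Reasoning
... | no  i≰x = begin
  conj (suc x ∷ map suc xs) (suc i) ≡⟨ cong length (filter-reject (suc i ≤?_) (i≰x ∘ ≤-pred)) ⟩
  conj (map suc xs) (suc i)         ≡⟨ conj-map-suc xs i ⟩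
  conj xs i                         ≡⟨ cong length (filter-reject (i ≤?_) i≰x) ⟨
  conj (x ∷ xs) i                   ∎
  where open ≡-Reasoning

conj-ones : ∀ k j → conj (replicate k 1) (suc (suc j)) ≡ 0
conj-ones zero    j = refl
conj-ones (suc k) j =
  trans (cong length (filter-reject (suc (suc j) ≤?_) {x = 1} {xs = replicate k 1} λ { (s≤s ()) }))
        (conj-ones k j)

conj-addColumn : ∀ μ k j → conj (addColumn μ k) (suc (suc j)) ≡ conj μ (suc j)
conj-addColumn μ k j = begin
  length (filter P? (map suc μ ++ replicate k 1))
    ≡⟨ cong length (filter-++ P? (map suc μ) _) ⟩
  length (filter P? (map suc μ) ++ filter P? (replicate k 1))
    ≡⟨ length-++ (filter P? (map suc μ)) ⟩
  conj (map suc μ) (suc (suc j)) + conj (replicate k 1) (suc (suc j))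
    ≡⟨ cong₂ _+_ (conj-map-suc μ (suc j)) (conj-ones k j) ⟩
  conj μ (suc j) + 0
    ≡⟨ +-identityʳ _ ⟩
  conj μ (suc j)
    ∎
  where
  open ≡-Reasoning
  P? = suc (suc j) ≤?_

srank≡⊖ : ∀ π i → srank π i ≡ part π i ⊖ conj π i
srank≡⊖ π i = ℤ.[+m]-[+n]≡m⊖n (part π i) (conj π i)

srank-addHook : ∀ a μ k {j} → j < length μ → j < a →
                srank (suc a ∷ addColumn μ k) (suc (suc j)) ≡ srank μ (suc j)
srank-addHook a μ k {j} j<l j<a = begin
  srank π (suc (suc j))
    ≡⟨ srank≡⊖ π (suc (suc j)) ⟩
  part π (suc (suc j)) ⊖ conj π (suc (suc j))
    ≡⟨ cong (part π (suc (suc j)) ⊖_) (cong length (filter-accept (suc (suc j) ≤?_) (s≤s j<a))) ⟩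
  part (addColumn μ k) (suc j) ⊖ suc (conj (addColumn μ k) (suc (suc j)))
    ≡⟨ cong₂ _⊖_ (part-addColumn μ k j<l) (cong suc (conj-addColumn μ k j)) ⟩
  suc (part μ (suc j)) ⊖ suc (conj μ (suc j))
    ≡⟨ ℤ.[1+m]⊖[1+n]≡m⊖n (part μ (suc j)) (conj μ (suc j)) ⟩
  part μ (suc j) ⊖ conj μ (suc j)
    ≡⟨ srank≡⊖ μ (suc j) ⟨
  srank μ (suc j)
    ∎
  where
  open ≡-Reasoning
  π = suc a ∷ addColumn μ k

rank : ℕ × ℕ → ℤ
rank (a , b) = a ⊖ b

srank-partitionOf-head : ∀ {a b f} → FrobeniusSymbol ((a , b) ∷ f) →
                         srank (partitionOf ((a , b) ∷ f)) 1 ≡ rank (a , b)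
srank-partitionOf-head {a} {b} {f} s = begin
  srank π 1        ≡⟨ srank≡⊖ π 1 ⟩
  suc a ⊖ conj π 1 ≡⟨ cong (λ l → suc a ⊖ length l) (filter-all (1 ≤?_) positive) ⟩
  suc a ⊖ length π ≡⟨ cong (suc a ⊖_) (length-partitionOf s) ⟩
  suc a ⊖ suc b    ≡⟨ ℤ.[1+m]⊖[1+n]≡m⊖n a b ⟩
  a ⊖ b            ∎
  where
  open ≡-Reasoning
  π : List ℕ
  π = partitionOf ((a , b) ∷ f)
  positive : Positive π
  positive = positive-partitionOf ((a , b) ∷ f)

srank-partitionOf-tail : ∀ {a b f j} → FrobeniusSymbol ((a , b) ∷ f) → j < length f →
                         srank (partitionOf ((a , b) ∷ f)) (suc (suc j)) ≡ srank (partitionOf f) (suc j)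
srank-partitionOf-tail {a} {f = f} s j<l = srank-addHook a (partitionOf f) _
  (≤-trans j<l (length≤length-partitionOf (Linked.tail s))) (≤-trans j<l (proj₁ (length-tail≤ s)))

module _ (Q : ℤ → Set) where

  RanksSatisfy : List ℕ → Set
  RanksSatisfy π = ∀ i → 1 ≤ i → i ≤ durfee π → Q (srank π i)

  ranksSatisfy⇒all : ∀ {f} → FrobeniusSymbol f → RanksSatisfy (partitionOf f) → All (Q ∘ rank) f
  ranksSatisfy⇒all {[]}          _ _ = []
  ranksSatisfy⇒all {(a , b) ∷ f} s H =
    subst Q (srank-partitionOf-head s) (H 1 ≤-refl (within (s≤s z≤n))) ∷
    ranksSatisfy⇒all (Linked.tail s) H′
    where
    within : ∀ {i} → i ≤ suc (length f) → i ≤ durfee (partitionOf ((a , b) ∷ f))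
    within = subst (_ ≤_) (sym (durfee-partitionOf ((a , b) ∷ f)))
    H′ : RanksSatisfy (partitionOf f)
    H′ (suc j) _ j<d =
      subst Q (srank-partitionOf-tail s j<l) (H (suc (suc j)) (s≤s z≤n) (within (s≤s j<l)))
      where j<l = subst (suc j ≤_) (durfee-partitionOf f) j<d

  all⇒ranksSatisfy : ∀ {f} → FrobeniusSymbol f → All (Q ∘ rank) f → RanksSatisfy (partitionOf f)
  all⇒ranksSatisfy {f} s qs i 1≤i i≤d = ranksUpTo s qs i 1≤i (subst (i ≤_) (durfee-partitionOf f) i≤d)
    where
    ranksUpTo : ∀ {f} → FrobeniusSymbol f → All (Q ∘ rank) f →
                ∀ i → 1 ≤ i → i ≤ length f → Q (srank (partitionOf f) i)
    ranksUpTo s (q ∷ _)  (suc zero)    _ _         = subst Q (sym (srank-partitionOf-head s)) q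
    ranksUpTo s (_ ∷ qs) (suc (suc j)) _ (s≤s j<l) =
      subst Q (sym (srank-partitionOf-tail s j<l)) (ranksUpTo (Linked.tail s) qs (suc j) (s≤s z≤n) j<l)

length-removeColumn≤ : ∀ xs → length (removeColumn xs) ≤ length xs
length-removeColumn≤ []                 = z≤n
length-removeColumn≤ (zero ∷ _)         = z≤n
length-removeColumn≤ (suc zero ∷ _)     = z≤n
length-removeColumn≤ (suc (suc x) ∷ xs) = s≤s (length-removeColumn≤ xs)

positive-removeColumn : ∀ xs → Positive (removeColumn xs)
positive-removeColumn []                 = []
positive-removeColumn (zero ∷ _)         = []
positive-removeColumn (suc zero ∷ _)     = []
positive-removeColumn (suc (suc x) ∷ xs) = s≤s z≤n ∷ positive-removeColumn xs

nonIncreasing-removeColumn : ∀ {xs} → NonIncreasing xs → NonIncreasing (removeColumn xs)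
nonIncreasing-removeColumn {[]}                         _ = []
nonIncreasing-removeColumn {zero ∷ _}                   _ = []
nonIncreasing-removeColumn {suc zero ∷ _}               _ = []
nonIncreasing-removeColumn {suc (suc x) ∷ []}           _ = [-]
nonIncreasing-removeColumn {suc (suc x) ∷ zero ∷ _}     _ = [-]
nonIncreasing-removeColumn {suc (suc x) ∷ suc zero ∷ _} _ = [-]
nonIncreasing-removeColumn {suc (suc x) ∷ suc (suc y) ∷ _} (s≤s y≤x ∷ d) =
  y≤x ∷ nonIncreasing-removeColumn d

removeColumn-addColumn : ∀ {μ} k → Positive μ → removeColumn (addColumn μ k) ≡ μ
removeColumn-addColumn {[]}        zero    _        = refl
removeColumn-addColumn {[]}        (suc k) _        = refl
removeColumn-addColumn {suc y ∷ μ} k       (_ ∷ ps) = cong (suc y ∷_) (removeColumn-addColumn k ps)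

ones-after-one : ∀ {xs} → NonIncreasing (1 ∷ xs) → Positive xs → xs ≡ replicate (length xs) 1
ones-after-one {[]}              _            _        = refl
ones-after-one {suc zero ∷ _}    (_ ∷ d)      (_ ∷ ps) = cong (1 ∷_) (ones-after-one d ps)
ones-after-one {suc (suc _) ∷ _} (s≤s () ∷ _) _

addColumn-removeColumn : ∀ {xs} → NonIncreasing xs → Positive xs →
                         addColumn (removeColumn xs) (length xs ∸ length (removeColumn xs)) ≡ xs
addColumn-removeColumn {[]}              _ _        = refl
addColumn-removeColumn {suc zero ∷ _}    d (_ ∷ ps) = cong (1 ∷_) (sym (ones-after-one d ps))
addColumn-removeColumn {suc (suc x) ∷ _} d (_ ∷ ps) =
  cong (suc (suc x) ∷_) (addColumn-removeColumn (Linked.tail d) ps)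

symbolWithin-[] : ∀ k → symbolWithin k [] ≡ []
symbolWithin-[] zero    = refl
symbolWithin-[] (suc k) = refl

≻-head-symbolWithin : ∀ k p rest → NonIncreasing (p ∷ rest) →
                      Connected _≻_ (just (ℕ.pred p , length rest)) (head (symbolWithin k (removeColumn rest)))
≻-head-symbolWithin zero    _       _                   _             = just-nothing
≻-head-symbolWithin (suc k) _       []                  _             = just-nothing
≻-head-symbolWithin (suc k) _       (zero ∷ _)          _             = just-nothing
≻-head-symbolWithin (suc k) _       (suc zero ∷ _)      _             = just-nothing
≻-head-symbolWithin (suc k) (suc p) (suc (suc x) ∷ xs) (s≤s x<p ∷ _) =
  just (x<p , s≤s (length-removeColumn≤ xs))

frobeniusSymbol-symbolWithin : ∀ k {π} → NonIncreasing π → FrobeniusSymbol (symbolWithin k π)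
frobeniusSymbol-symbolWithin zero    _              = []
frobeniusSymbol-symbolWithin (suc k) {[]}       _ = []
frobeniusSymbol-symbolWithin (suc k) {p ∷ rest} d =
  ≻-head-symbolWithin k p rest d ∷′
  frobeniusSymbol-symbolWithin k (nonIncreasing-removeColumn (Linked.tail d))

partitionOf-symbolWithin : ∀ k {π} → length π ≤ k → NonIncreasing π → Positive π →
                           partitionOf (symbolWithin k π) ≡ π
partitionOf-symbolWithin k       {[]}           _         _ _        = cong partitionOf (symbolWithin-[] k)
partitionOf-symbolWithin (suc k) {suc p ∷ rest} (s≤s l≤k) d (_ ∷ ps) = cong (suc p ∷_) (begin
  addColumn μ (length rest ∸ length μ)
    ≡⟨ cong (λ ν → addColumn ν (length rest ∸ length ν)) IH ⟩
  addColumn (removeColumn rest) (length rest ∸ length (removeColumn rest))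
    ≡⟨ addColumn-removeColumn (Linked.tail d) ps ⟩
  rest ∎)
  where
  open ≡-Reasoning
  d′ = nonIncreasing-removeColumn (Linked.tail d)
  μ  = partitionOf (symbolWithin k (removeColumn rest))
  IH = partitionOf-symbolWithin k (≤-trans (length-removeColumn≤ rest) l≤k) d′ (positive-removeColumn rest)

symbolWithin-partitionOf : ∀ k {f} → FrobeniusSymbol f → length (partitionOf f) ≤ k →
                           symbolWithin k (partitionOf f) ≡ f
symbolWithin-partitionOf k       {[]}          _ _ = symbolWithin-[] k
symbolWithin-partitionOf zero    {(a , b) ∷ f} s l≤0 with () ← subst (_≤ 0) (length-partitionOf s) l≤0
symbolWithin-partitionOf (suc k) {(a , b) ∷ f} s l≤k = cong₂ (λ b′ f′ → (a , b′) ∷ f′)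
  (suc-injective (length-partitionOf s))
  (trans (cong (symbolWithin k) (removeColumn-addColumn _ (positive-partitionOf f)))
         (symbolWithin-partitionOf k (Linked.tail s) (≤-trans (length-partitionOf-tail≤ s) b≤k)))
  where b≤k = ≤-pred (subst (_≤ suc k) (length-partitionOf s) l≤k)

hook-≻ : ∀ {x x′} → x ≻ x′ → hook x′ < hook x
hook-≻ (a′<a , b′<b) = s≤s (+-mono-< a′<a b′<b)

≻⇒gap : ∀ {a b a′ b′} → (a , b) ≻ (a′ , b′) →
        2 + ∣ (a + b′) ⊖ (a′ + b) ∣ ≤ (a + b) ∸ (a′ + b′)
≻⇒gap {a′ = a′} {b′ = b′} (a′<a , b′<b)
  with m≤n⇒∃[o]m+o≡n a′<a | m≤n⇒∃[o]m+o≡n b′<b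
... | u , refl | v , refl = begin
  2 + ∣ (suc a′ + u + b′) ⊖ (a′ + (suc b′ + v)) ∣ ≡⟨ cong (λ z → 2 + ∣ z ∣) difference ⟩
  2 + ∣ u ⊖ v ∣                                   ≤⟨ +-monoʳ-≤ 2 ∣u⊖v∣≤u+v ⟩
  2 + (u + v)                                     ≡⟨ m+n∸m≡n (a′ + b′) (2 + (u + v)) ⟨
  (a′ + b′ + (2 + (u + v))) ∸ (a′ + b′)           ≡⟨ cong (_∸ (a′ + b′)) (total a′ b′ u v) ⟩
  (suc a′ + u + (suc b′ + v)) ∸ (a′ + b′)         ∎
  where
  open ≤-Reasoning
  left : ∀ a′ b′ u → suc a′ + u + b′ ≡ suc (a′ + b′) + u
  left = solve-∀
  right : ∀ a′ b′ v → a′ + (suc b′ + v) ≡ suc (a′ + b′) + v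
  right = solve-∀
  total : ∀ a′ b′ u v → a′ + b′ + (2 + (u + v)) ≡ suc a′ + u + (suc b′ + v)
  total = solve-∀
  difference : (suc a′ + u + b′) ⊖ (a′ + (suc b′ + v)) ≡ u ⊖ v
  difference = trans (cong₂ _⊖_ (left a′ b′ u) (right a′ b′ v))
                     (ℤ.+-cancelˡ-⊖ (suc (a′ + b′)) u v)
  ∣u⊖v∣≤u+v : ∣ u ⊖ v ∣ ≤ u + v
  ∣u⊖v∣≤u+v = ≤-trans (ℤ.∣m⊝n∣≤m⊔n u v) (m⊔n≤m+n u v)

gap⇒< : ∀ {a b a′ b′ d} → d + (a′ + b′) ≡ a + b → 2 + (a + b′) ≤ (a′ + b) + d → b′ < b
gap⇒< {a} {b} {a′} {b′} {d} d+s′≡s gap = *-cancelˡ-≤ 2 (+-cancelˡ-≤ (a + a′) _ _ (begin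
  a + a′ + 2 * suc b′      ≡⟨ rearrange₁ a a′ b′ ⟩
  2 + (a + b′) + (a′ + b′) ≤⟨ +-monoˡ-≤ (a′ + b′) gap ⟩
  a′ + b + d + (a′ + b′)   ≡⟨ +-assoc (a′ + b) d (a′ + b′) ⟩
  a′ + b + (d + (a′ + b′)) ≡⟨ cong (a′ + b +_) d+s′≡s ⟩
  a′ + b + (a + b)         ≡⟨ rearrange₂ a a′ b ⟩
  a + a′ + 2 * b           ∎))
  where
  open ≤-Reasoning
  rearrange₁ : ∀ a a′ b′ → a + a′ + 2 * suc b′ ≡ 2 + (a + b′) + (a′ + b′)
  rearrange₁ = solve-∀
  rearrange₂ : ∀ a a′ b → a′ + b + (a + b) ≡ a + a′ + 2 * b
  rearrange₂ = solve-∀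

gap⇒≻ : ∀ {a b a′ b′} → 2 + ∣ (a + b′) ⊖ (a′ + b) ∣ ≤ (a + b) ∸ (a′ + b′) →
        (a , b) ≻ (a′ , b′)
gap⇒≻ {a} {b} {a′} {b′} gap =
  gap⇒< {b} {a} {b′} {a′} d+s′≡s′ gapᵃ , gap⇒< {a} {b} {a′} {b′} d+s′≡s gapᵇ
  where
  d = (a + b) ∸ (a′ + b′)
  d+s′≡s : d + (a′ + b′) ≡ a + b
  d+s′≡s = m∸n+n≡m {a + b} {a′ + b′} (<⇒≤ (m∸n≢0⇒n<m d≢0))
    where
    d≢0 : d ≢ 0
    d≢0 d≡0 = n≮0 (subst (1 ≤_) d≡0 (m+n≤o⇒m≤o 1 gap))
  d+s′≡s′ : d + (b′ + a′) ≡ b + a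
  d+s′≡s′ = subst₂ (λ x y → d + x ≡ y) (+-comm a′ b′) (+-comm a b) d+s′≡s
  gapᵇ : 2 + (a + b′) ≤ (a′ + b) + d
  gapᵇ = +∣⊖∣≤⇒ 2 gap
  gapᵃ : 2 + (b + a′) ≤ (b′ + a) + d
  gapᵃ = subst₂ (λ x y → 2 + x ≤ y + d) (+-comm a′ b) (+-comm a b′) (+∣⊖∣≤⇒ 2 gap′)
    where
    gap′ : 2 + ∣ (a′ + b) ⊖ (a + b′) ∣ ≤ d
    gap′ = subst (λ z → 2 + z ≤ d) (ℤ.∣m⊖n∣≡∣n⊖m∣ (a + b′) (a′ + b)) gap

-- Hooks and coloured parts

module Colouring (r : ℕ) where

  parityBit : ℕ → ℕ
  parityBit h with h % 2 ℕ.≟ r % 2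
  ... | yes _ = 1
  ... | no  _ = 0

  parityBit≤1 : ∀ h → parityBit h ≤ 1
  parityBit≤1 h with h % 2 ℕ.≟ r % 2
  ... | yes _ = ≤-refl
  ... | no  _ = z≤n

  ≢₂⇔parityBit≡0 : ∀ h → (¬ (h ≡₂ r)) ⇔ parityBit h ≡ 0
  ≢₂⇔parityBit≡0 h with h % 2 ℕ.≟ r % 2
  ... | yes h≡₂r = mk⇔ (λ h≢₂r → ⊥-elim (h≢₂r h≡₂r)) (λ ())
  ... | no  h≢₂r = mk⇔ (λ _ → refl) (λ _ → h≢₂r)

  +parityBit≡₂r : ∀ s → (s + parityBit (suc s)) ≡₂ r
  +parityBit≡₂r s with suc s % 2 ℕ.≟ r % 2
  ... | yes 1+s≡₂r = trans (cong (_% 2) (+-comm s 1)) 1+s≡₂r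
  ... | no  1+s≢₂r =
    trans (cong (_% 2) (+-identityʳ s)) (≢₂-≢₂⇒≡₂ {s} {suc s} {r} (n≢₂1+n s) 1+s≢₂r)

  shiftedRank : ℕ × ℕ → ℕ
  shiftedRank (h , c) = parityBit h + 2 * c

  +shiftedRank≡₂r : ∀ s c → (s + shiftedRank (suc s , c)) ≡₂ r
  +shiftedRank≡₂r s c = trans (cong (_% 2) (rearrange s (parityBit (suc s)) c))
                              (trans (2*m+n≡₂n c (s + parityBit (suc s))) (+parityBit≡₂r s))
    where
    rearrange : ∀ s q c → s + (q + 2 * c) ≡ 2 * c + (s + q)
    rearrange = solve-∀

  record Corresponds (x y : ℕ × ℕ) : Set where
    constructor corresponds
    field
      hook≡ : proj₁ y ≡ hook x
      rank≡ : proj₁ x + r ≡ proj₂ x + shiftedRank y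

  toColoured : ℕ × ℕ → ℕ × ℕ
  toColoured (a , b) = hook (a , b) , (a + r ∸ b) / 2

  -- Solves a + b = h - 1 and a - b = shiftedRank (h , c) - r.
  fromColoured : ℕ × ℕ → ℕ × ℕ
  fromColoured (h , c) = arm , ℕ.pred h ∸ arm
    where arm = (ℕ.pred h + shiftedRank (h , c) ∸ r) / 2

  corresponds⇒≡toColoured : ∀ {x y} → Corresponds x y → y ≡ toColoured x
  corresponds⇒≡toColoured {a , b} {h , c} (corresponds refl a+r≡b+X) = cong (h ,_) (sym (begin
    (a + r ∸ b) / 2                   ≡⟨ cong (λ z → (z ∸ b) / 2) a+r≡b+X ⟩
    (b + shiftedRank (h , c) ∸ b) / 2 ≡⟨ cong (_/ 2) (m+n∸m≡n b _) ⟩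
    (parityBit h + 2 * c) / 2         ≡⟨ [bit+2*n]/2≡n c (parityBit≤1 h) ⟩
    c                                 ∎))
    where open ≡-Reasoning

  corresponds⇒≡fromColoured : ∀ {x y} → Corresponds x y → x ≡ fromColoured y
  corresponds⇒≡fromColoured {a , b} {h , c} (corresponds refl a+r≡b+X) =
    sym (cong₂ _,_ arm≡a (trans (cong (a + b ∸_) arm≡a) (m+n∸m≡n a b)))
    where
    open ≡-Reasoning
    X = shiftedRank (h , c)
    arm≡a : (a + b + X ∸ r) / 2 ≡ a
    arm≡a = begin
      (a + b + X ∸ r) / 2   ≡⟨ cong (λ z → (z ∸ r) / 2) (+-assoc a b X) ⟩
      (a + (b + X) ∸ r) / 2 ≡⟨ cong (λ z → (a + z ∸ r) / 2) a+r≡b+X ⟨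
      (a + (a + r) ∸ r) / 2 ≡⟨ cong (λ z → (z ∸ r) / 2) (+-assoc a a r) ⟨
      (a + a + r ∸ r) / 2   ≡⟨ cong (_/ 2) (m+n∸n≡m (a + a) r) ⟩
      (a + a) / 2           ≡⟨ cong (λ z → (a + z) / 2) (+-identityʳ a) ⟨
      (0 + 2 * a) / 2       ≡⟨ [bit+2*n]/2≡n a z≤n ⟩
      a                     ∎

  corresponds-toColoured : ∀ {a b} → b ≤ a + r → Corresponds (a , b) (toColoured (a , b))
  corresponds-toColoured {a} {b} b≤a+r = corresponds refl (begin
    a + r                                        ≡⟨ m+[n∸m]≡n b≤a+r ⟨
    b + X                                        ≡⟨ cong (b +_) (n≡n%2+2*[n/2] X) ⟩
    b + (X % 2 + 2 * (X / 2))                    ≡⟨ cong (λ p → b + (p + 2 * (X / 2))) X%2≡parityBit ⟩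
    b + (parityBit (hook (a , b)) + 2 * (X / 2)) ∎)
    where
    open ≡-Reasoning
    X = a + r ∸ b
    double : ∀ a r → a + (a + r) ≡ 2 * a + r
    double = solve-∀
    a+b+X≡2a+r : a + b + X ≡ 2 * a + r
    a+b+X≡2a+r = trans (+-assoc a b X) (trans (cong (a +_) (m+[n∸m]≡n b≤a+r)) (double a r))
    a+b+X%2≡₂r : (a + b + X % 2) ≡₂ r
    a+b+X%2≡₂r = trans (+%2≡₂+ (a + b) X) (trans (cong (_% 2) a+b+X≡2a+r) (2*m+n≡₂n a r))
    X%2≡parityBit : X % 2 ≡ parityBit (suc (a + b))
    X%2≡parityBit = +-cancelˡ-≡₂-bit (a + b) (n%2≤1 X) (parityBit≤1 (suc (a + b)))
                                     (trans a+b+X%2≡₂r (sym (+parityBit≡₂r (a + b))))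

  corresponds-fromColoured : ∀ {h c} → ∣ shiftedRank (h , c) ⊖ r ∣ < h →
                             Corresponds (fromColoured (h , c)) (h , c)
  corresponds-fromColoured {suc s} {c} bound =
    corresponds (cong suc (sym (m+[n∸m]≡n arm≤s))) (+-cancelˡ-≡ arm _ _ (begin
      arm + (arm + r)     ≡⟨ +-assoc arm arm r ⟨
      arm + arm + r       ≡⟨ cong (λ z → arm + z + r) (+-identityʳ arm) ⟨
      2 * arm + r         ≡⟨ +-comm (2 * arm) r ⟩
      r + 2 * arm         ≡⟨ cong (r +_) 2arm≡e ⟩
      r + e               ≡⟨ m+[n∸m]≡n r≤s+X ⟩
      s + X               ≡⟨ cong (_+ X) (m+[n∸m]≡n arm≤s) ⟨
      arm + (s ∸ arm) + X ≡⟨ +-assoc arm (s ∸ arm) X ⟩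
      arm + (s ∸ arm + X) ∎))
    where
    open ≡-Reasoning
    X = shiftedRank (suc s , c)
    e = s + X ∸ r
    arm = e / 2
    X≤r+s : X ≤ r + s
    X≤r+s = ≤-trans (m≤n+∣m⊖n∣ X r) (+-monoʳ-≤ r (≤-pred bound))
    r≤s+X : r ≤ s + X
    r≤s+X = ≤-trans (m≤n+∣m⊖n∣ r X)
                    (subst (X + ∣ r ⊖ X ∣ ≤_) (+-comm X s) (+-monoʳ-≤ X ∣r⊖X∣≤s))
      where
      ∣r⊖X∣≤s : ∣ r ⊖ X ∣ ≤ s
      ∣r⊖X∣≤s = ≤-pred (subst (_< suc s) (ℤ.∣m⊖n∣≡∣n⊖m∣ X r) bound)
    2arm≡e : 2 * arm ≡ e
    2arm≡e = sym (trans (n≡n%2+2*[n/2] e) (cong (_+ 2 * arm) e-even))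
      where
      e-even : e % 2 ≡ 0
      e-even = +≡₂⇒even r e (trans (cong (_% 2) (m+[n∸m]≡n r≤s+X)) (+shiftedRank≡₂r s c))
    arm≤s : arm ≤ s
    arm≤s = *-cancelˡ-≤ 2 (subst (_≤ 2 * s) (sym 2arm≡e) (m≤n+o⇒m∸n≤o (s + X) r s+X≤r+2s))
      where
      s+X≤r+2s : s + X ≤ r + 2 * s
      s+X≤r+2s = ≤-trans (+-monoʳ-≤ s X≤r+s)
        (≤-reflexive (trans (x∙yz≈y∙xz s r s) (cong (λ z → r + (s + z)) (sym (+-identityʳ s)))))

  condI⇔ : ∀ h c → CondI r (h , c) ⇔ ∣ shiftedRank (h , c) ⊖ r ∣ < h
  condI⇔ h c with h % 2 ℕ.≟ r % 2
  ... | yes h≡₂r = mk⇔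
    (λ (bound , _) → subst Bound eq (bound h≡₂r))
    (λ bound → (λ _ → subst Bound (sym eq) bound) , λ h≢₂r → ⊥-elim (h≢₂r h≡₂r))
    where
    Bound = λ z → ∣ z ∣ < h
    eq = [+m]-[+n]+1≡1+m⊖n (2 * c) r
  ... | no  h≢₂r = mk⇔
    (λ (_ , bound) → subst Bound eq (bound h≢₂r))
    (λ bound → (λ h≡₂r → ⊥-elim (h≢₂r h≡₂r)) , λ _ → subst Bound (sym eq) bound)
    where
    Bound = λ z → ∣ z ∣ < h
    eq = ℤ.[+m]-[+n]≡m⊖n (2 * c) r

  Gap : ℕ → ℕ → ℤ → Set
  Gap h h′ z = 2 + ∣ z ∣ ≤ h ∸ h′

  condII⇔ : ∀ h c h′ d → CondII r (h , c) (h′ , d) ⇔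
                         Gap h h′ (shiftedRank (h , c) ⊖ shiftedRank (h′ , d))
  condII⇔ h c h′ d with h % 2 ℕ.≟ r % 2 | h′ % 2 ℕ.≟ r % 2
  ... | yes h≡₂r | yes h′≡₂r = mk⇔
    (λ (gap , _ , _) → subst (Gap h h′) eq (gap h≡₂h′))
    (λ gap → (λ _ → subst (Gap h h′) (sym eq) gap) ,
             (λ h≢₂h′ _ → ⊥-elim (h≢₂h′ h≡₂h′)) ,
             (λ h′≢₂h _ → ⊥-elim (h′≢₂h (sym h≡₂h′))))
    where
    h≡₂h′ = trans h≡₂r (sym h′≡₂r)
    eq = trans (ℤ.[+m]-[+n]≡m⊖n (2 * c) (2 * d)) (sym (ℤ.[1+m]⊖[1+n]≡m⊖n (2 * c) (2 * d)))
  ... | yes h≡₂r | no  h′≢₂r = mk⇔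
    (λ (_ , _ , gap) → subst (Gap h h′) eq (gap h′≢₂h h≡₂r))
    (λ gap → (λ h≡₂h′ → ⊥-elim (h′≢₂h (sym h≡₂h′))) ,
             (λ _ h′≡₂r → ⊥-elim (h′≢₂r h′≡₂r)) ,
             (λ _ _ → subst (Gap h h′) (sym eq) gap))
    where
    h′≢₂h = λ h′≡₂h → h′≢₂r (trans h′≡₂h h≡₂r)
    eq = [+m]-[+n]+1≡1+m⊖n (2 * c) (2 * d)
  ... | no  h≢₂r | yes h′≡₂r = mk⇔
    (λ (_ , gap , _) → subst (Gap h h′) eq (gap h≢₂h′ h′≡₂r))
    (λ gap → (λ h≡₂h′ → ⊥-elim (h≢₂h′ h≡₂h′)) ,
             (λ _ _ → subst (Gap h h′) (sym eq) gap) ,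
             (λ _ h≡₂r → ⊥-elim (h≢₂r h≡₂r)))
    where
    h≢₂h′ = λ h≡₂h′ → h≢₂r (trans h≡₂h′ h′≡₂r)
    eq = [+m]-[+n]-1≡m⊖1+n (2 * c) (2 * d)
  ... | no  h≢₂r | no  h′≢₂r = mk⇔
    (λ (gap , _ , _) → subst (Gap h h′) eq (gap h≡₂h′))
    (λ gap → (λ _ → subst (Gap h h′) (sym eq) gap) ,
             (λ h≢₂h′ _ → ⊥-elim (h≢₂h′ h≡₂h′)) ,
             (λ _ h≡₂r → ⊥-elim (h≢₂r h≡₂r)))
    where
    h≡₂h′ = ≢₂-≢₂⇒≡₂ {h} {r} {h′} h≢₂r (λ r≡₂h′ → h′≢₂r (sym r≡₂h′))
    eq = ℤ.[+m]-[+n]≡m⊖n (2 * c) (2 * d)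

  corresponds⇒condI : ∀ {x y} → Corresponds x y → CondI r y
  corresponds⇒condI {a , b} {h , c} (corresponds refl a+r≡b+X) = Equivalence.from (condI⇔ h c) (begin-strict
    ∣ X ⊖ r ∣   ≡⟨ cong ∣_∣ (+≡+⇒⊖≡⊖ {X} {b} {r} {a} X+b≡r+a) ⟩
    ∣ a ⊖ b ∣   ≤⟨ ℤ.∣m⊝n∣≤m⊔n a b ⟩
    a ⊔ b       ≤⟨ m⊔n≤m+n a b ⟩
    a + b       <⟨ n<1+n (a + b) ⟩
    suc (a + b) ∎)
    where
    open ≤-Reasoning
    X = shiftedRank (h , c)
    X+b≡r+a : X + b ≡ r + a
    X+b≡r+a = trans (+-comm X b) (trans (sym a+r≡b+X) (+-comm a r))

  shiftedRank-⊖ : ∀ {a b a′ b′ y y′} → Corresponds (a , b) y → Corresponds (a′ , b′) y′ →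
                  shiftedRank y ⊖ shiftedRank y′ ≡ (a + b′) ⊖ (a′ + b)
  shiftedRank-⊖ {a} {b} {a′} {b′} {y} {y′} (corresponds _ a+r≡b+X) (corresponds _ a′+r≡b′+X′) =
    +≡+⇒⊖≡⊖ {X} {a′ + b} {X′} {a + b′} (+-cancelʳ-≡ r (X + (a′ + b)) (X′ + (a + b′)) (begin
      X + (a′ + b) + r    ≡⟨ rearrange₁ X a′ b r ⟩
      (b + X) + (a′ + r)  ≡⟨ cong₂ _+_ (sym a+r≡b+X) a′+r≡b′+X′ ⟩
      (a + r) + (b′ + X′) ≡⟨ rearrange₂ a r b′ X′ ⟩
      X′ + (a + b′) + r   ∎))
    where
    open ≡-Reasoning
    X  = shiftedRank y
    X′ = shiftedRank y′
    rearrange₁ : ∀ X a′ b r → X + (a′ + b) + r ≡ (b + X) + (a′ + r)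
    rearrange₁ = solve-∀
    rearrange₂ : ∀ a r b′ X′ → (a + r) + (b′ + X′) ≡ X′ + (a + b′) + r
    rearrange₂ = solve-∀

  corresponds⇒≻⇔condII : ∀ {x x′ y y′} → Corresponds x y → Corresponds x′ y′ →
                         x ≻ x′ ⇔ CondII r y y′
  corresponds⇒≻⇔condII {a , b} {a′ , b′} {h , c} {h′ , d}
                       x~y@(corresponds refl _) x′~y′@(corresponds refl _) = mk⇔
    (λ x≻x′ → Equivalence.from (condII⇔ h c h′ d) (subst (Gap h h′) (sym difference) (≻⇒gap x≻x′)))
    (λ cond → gap⇒≻ (subst (Gap h h′) difference (Equivalence.to (condII⇔ h c h′ d) cond)))
    where
    difference = shiftedRank-⊖ {y = h , c} {y′ = h′ , d} x~y x′~y′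

  module Bounds (M : ℕ) where

    -- 2 - r ≤ a - b ≤ M - r - 2, without subtraction
    RankBounded : ℕ × ℕ → Set
    RankBounded (a , b) = b + 2 ≤ a + r × a + r + 2 ≤ b + M

    InColourRange : ℕ × ℕ → Set
    InColourRange (h , c) = (1 ≤ h) × (1 ≤ c) × (c ≤ M / 2 ∸ 1)

    Admissible : ℕ × ℕ → Set
    Admissible y = InColourRange y × CondI r y × CondIII M (M / 2) r y

    rankBounded⇔ : ∀ {a b X} → a + r ≡ b + X → RankBounded (a , b) ⇔ (2 ≤ X × X + 2 ≤ M)
    rankBounded⇔ {a} {b} {X} a+r≡b+X = mk⇔
      (λ (lo , hi) → +-cancelˡ-≤ b 2 X (subst (b + 2 ≤_) a+r≡b+X lo) ,
                     +-cancelˡ-≤ b (X + 2) M (subst (_≤ b + M) shifted hi))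
      (λ (lo , hi) → subst (b + 2 ≤_) (sym a+r≡b+X) (+-monoʳ-≤ b lo) ,
                     subst (_≤ b + M) (sym shifted) (+-monoʳ-≤ b hi))
      where
      shifted : a + r + 2 ≡ b + (X + 2)
      shifted = trans (cong (_+ 2) a+r≡b+X) (+-assoc b X 2)

    colourBounded⇔ : ∀ h c → (1 ≤ c × c ≤ M / 2 ∸ 1 × CondIII M (M / 2) r (h , c)) ⇔
                             (2 ≤ shiftedRank (h , c) × shiftedRank (h , c) + 2 ≤ M)
    colourBounded⇔ h c = mk⇔
      (λ (1≤c , c≤ , cond) →
         let lo , hi = Equivalence.to bounds (1≤c , c≤ , λ M-even e → parity⇒ (cond M-even e))
         in lo , subst (_ ≤_) (sym M≡) hi)
      (λ (lo , hi) → let 1≤c , c≤ , cond = Equivalence.from bounds (lo , subst (_ ≤_) M≡ hi)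
                     in 1≤c , c≤ , λ M-even e → parity⇐ (cond M-even e))
      where
      bounds  = colourBounds⇔ c (M / 2) (parityBit≤1 h) (n%2≤1 M)
      M≡      = n≡n%2+2*[n/2] M
      parity⇒ = Equivalence.to (≢₂⇔parityBit≡0 h)
      parity⇐ = Equivalence.from (≢₂⇔parityBit≡0 h)

    corresponds⇒rankBounded⇔admissible : ∀ {x y} → Corresponds x y → RankBounded x ⇔ Admissible y
    corresponds⇒rankBounded⇔admissible {a , b} {h , c} x~y@(corresponds refl a+r≡b+X) = mk⇔
      (λ bounded → let 1≤c , c≤ , cond = Equivalence.from colour (Equivalence.to ranks bounded)
                   in (s≤s z≤n , 1≤c , c≤) , corresponds⇒condI {y = h , c} x~y , cond)
      (λ ((_ , 1≤c , c≤) , _ , cond) → Equivalence.from ranks (Equivalence.to colour (1≤c , c≤ , cond)))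
      where
      ranks  = rankBounded⇔ {X = shiftedRank (h , c)} a+r≡b+X
      colour = colourBounded⇔ h c

-- Partitions, Frobenius symbols and coloured partitions

linked-map : ∀ {A B : Set} {P : A → Set} {R : A → A → Set} {S : B → B → Set} (f : A → B) →
             (∀ {x y} → P x → P y → R x y → S (f x) (f y)) →
             ∀ {xs} → All P xs → Linked R xs → Linked S (map f xs)
linked-map f step []              []         = []
linked-map f step (_ ∷ [])        [-]        = [-]
linked-map f step (px ∷ py ∷ pxs) (rxy ∷ rs) = step px py rxy ∷ linked-map f step (py ∷ pxs) rs

module _ (M r : ℕ) where

  open Colouring r
  open Bounds M

  RankInterval : ℤ → Set
  RankInterval s = (ℤ.+ 2 ℤ.- ℤ.+ r ℤ.≤ s) × (s ℤ.≤ ℤ.+ M ℤ.- ℤ.+ r ℤ.- ℤ.+ 2)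

  rankInterval⇔rankBounded : ∀ {x} → RankInterval (rank x) ⇔ RankBounded x
  rankInterval⇔rankBounded {a , b} = mk⇔
    (λ (lo , hi) →
       subst (_≤ a + r) (+-comm 2 b) (Equivalence.to lower (subst (ℤ._≤ a ⊖ b) 2-r lo)) ,
       subst₂ _≤_ (sym (+-assoc a r 2)) (+-comm M b) (Equivalence.to upper (subst (a ⊖ b ℤ.≤_) M-r-2 hi)))
    (λ (lo , hi) →
       subst (ℤ._≤ a ⊖ b) (sym 2-r) (Equivalence.from lower (subst (_≤ a + r) (+-comm b 2) lo)) ,
       subst (a ⊖ b ℤ.≤_) (sym M-r-2) (Equivalence.from upper (subst₂ _≤_ (+-assoc a r 2) (+-comm b M) hi)))
    where
    lower = ⊖≤⊖⇔ 2 r a b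
    upper = ⊖≤⊖⇔ a b M (r + 2)
    2-r   = ℤ.[+m]-[+n]≡m⊖n 2 r
    M-r-2 = [+m]-[+n]-2≡m⊖[n+2] M r

  InFrobenius : ℕ → List (ℕ × ℕ) → Set
  InFrobenius n f = FrobeniusSymbol f × All RankBounded f × sum (map hook f) ≡ n

  InA⇒InFrobenius : ∀ {n π} → InA M r n π → InFrobenius n (frobeniusSymbol π)
  InA⇒InFrobenius {π = π} ((pos , dec , sum≡n) , ranks) =
    symbol ,
    All.map (Equivalence.to rankInterval⇔rankBounded) (ranksSatisfy⇒all RankInterval symbol ranks′) ,
    trans (sym (sum-partitionOf symbol)) (trans (cong sum π≡) sum≡n)
    where
    symbol = frobeniusSymbol-symbolWithin (length π) dec
    π≡     = partitionOf-symbolWithin (length π) ≤-refl dec pos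
    ranks′ = subst (RanksSatisfy RankInterval) (sym π≡) ranks

  InFrobenius⇒InA : ∀ {n f} → InFrobenius n f → InA M r n (partitionOf f)
  InFrobenius⇒InA {f = f} (symbol , bounded , sum≡n) =
    (positive-partitionOf f , nonIncreasing-partitionOf symbol , trans (sum-partitionOf symbol) sum≡n) ,
    all⇒ranksSatisfy RankInterval symbol (All.map (Equivalence.from rankInterval⇔rankBounded) bounded)

  partitions⤖frobeniusSymbols : ∀ n → RestrictedBijection (InA M r n) (InFrobenius n)
  partitions⤖frobeniusSymbols n = record
    { to        = frobeniusSymbol
    ; from      = partitionOf
    ; to-pres   = InA⇒InFrobenius
    ; from-pres = InFrobenius⇒InA
    ; from∘to   = λ ((pos , dec , _) , _) → partitionOf-symbolWithin _ ≤-refl dec pos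
    ; to∘from   = λ (symbol , _) → symbolWithin-partitionOf _ symbol ≤-refl
    }

  rankBounded⇒corresponds : ∀ {x} → RankBounded x → Corresponds x (toColoured x)
  rankBounded⇒corresponds {a , b} (lo , _) = corresponds-toColoured (≤-trans (m≤m+n b 2) lo)

  admissible⇒corresponds : ∀ {y} → Admissible y → Corresponds (fromColoured y) y
  admissible⇒corresponds {h , c} (_ , condI , _) = corresponds-fromColoured (Equivalence.to (condI⇔ h c) condI)

  admissible-toColoured : ∀ {x} → RankBounded x → Admissible (toColoured x)
  admissible-toColoured bounded =
    Equivalence.to (corresponds⇒rankBounded⇔admissible (rankBounded⇒corresponds bounded)) bounded

  rankBounded-fromColoured : ∀ {y} → Admissible y → RankBounded (fromColoured y)
  rankBounded-fromColoured admissible =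
    Equivalence.from (corresponds⇒rankBounded⇔admissible (admissible⇒corresponds admissible)) admissible

  InC⇒all-admissible : ∀ {n α} → InC M r n α → All Admissible α
  InC⇒all-admissible ((inRange , _ , _) , condIs , _ , condIIIs) =
    All.zipWith (λ (p , i , iii) → p , i , iii) (inRange , All.zip (condIs , condIIIs))

  all-admissible⇒InC : ∀ {n α} → All Admissible α → Linked ColStep α → Linked (CondII r) α →
                       sum (map proj₁ α) ≡ n → InC M r n α
  all-admissible⇒InC admissible steps condIIs sum≡n =
    (All.map proj₁ admissible , steps , sum≡n) , All.map (proj₁ ∘ proj₂) admissible , condIIs ,
    All.map (proj₂ ∘ proj₂) admissible

  InFrobenius⇒InC : ∀ {n f} → InFrobenius n f → InC M r n (map toColoured f)
  InFrobenius⇒InC {f = f} (symbol , bounded , sum≡n) = all-admissible⇒InC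
    (All.map⁺ (All.map admissible-toColoured bounded))
    (Linked.map⁺ (Linked.map (λ x≻x′ → colStep (hook-≻ x≻x′)) symbol))
    (linked-map toColoured condII bounded symbol)
    (trans (cong sum (sym (map-∘ f))) sum≡n)
    where
    colStep : ∀ {h h′ c c′} → h′ < h → ColStep (h , c) (h′ , c′)
    colStep h′<h = <⇒≤ h′<h , λ h≡h′ → ⊥-elim (<⇒≢ h′<h (sym h≡h′))
    condII : ∀ {x x′} → RankBounded x → RankBounded x′ → x ≻ x′ →
             CondII r (toColoured x) (toColoured x′)
    condII bx bx′ =
      Equivalence.to (corresponds⇒≻⇔condII (rankBounded⇒corresponds bx) (rankBounded⇒corresponds bx′))

  InC⇒InFrobenius : ∀ {n α} → InC M r n α → InFrobenius n (map fromColoured α)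
  InC⇒InFrobenius {α = α} inC@((_ , _ , sum≡n) , _ , condIIs , _) =
    linked-map fromColoured decreasing admissible condIIs ,
    All.map⁺ (All.map rankBounded-fromColoured admissible) ,
    trans (cong sum (trans (sym (map-∘ α)) (map-cong-local (All.map hook≡ admissible)))) sum≡n
    where
    admissible = InC⇒all-admissible inC
    decreasing : ∀ {y y′} → Admissible y → Admissible y′ → CondII r y y′ →
                 fromColoured y ≻ fromColoured y′
    decreasing ay ay′ =
      Equivalence.from (corresponds⇒≻⇔condII (admissible⇒corresponds ay) (admissible⇒corresponds ay′))
    hook≡ : ∀ {y} → Admissible y → hook (fromColoured y) ≡ proj₁ y
    hook≡ ay = sym (Corresponds.hook≡ (admissible⇒corresponds ay))

  frobeniusSymbols⤖colouredPartitions : ∀ n → RestrictedBijection (InFrobenius n) (InC M r n)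
  frobeniusSymbols⤖colouredPartitions n = record
    { to        = map toColoured
    ; from      = map fromColoured
    ; to-pres   = InFrobenius⇒InC
    ; from-pres = InC⇒InFrobenius
    ; from∘to   = λ {f} (_ , bounded , _) → trans (sym (map-∘ f)) (map-id-local (All.map from∘to bounded))
    ; to∘from   = λ {α} inC →
        trans (sym (map-∘ α)) (map-id-local (All.map to∘from (InC⇒all-admissible inC)))
    }
    where
    from∘to : ∀ {x} → RankBounded x → fromColoured (toColoured x) ≡ x
    from∘to bx = sym (corresponds⇒≡fromColoured (rankBounded⇒corresponds bx))
    to∘from : ∀ {y} → Admissible y → toColoured (fromColoured y) ≡ y
    to∘from ay = sym (corresponds⇒≡toColoured (admissible⇒corresponds ay))

theorem3 : (M r : ℕ) → 1 ≤ r → 2 * r ≤ M → (n : ℕ) →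
    Equinumerous (InA M r n) (InC M r n)
theorem3 M r _ _ n = restrictedBijection⇒equinumerous
  (restrictedBijection-trans (partitions⤖frobeniusSymbols M r n) (frobeniusSymbols⤖colouredPartitions M r n))
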